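{- For a finite poset $P$, exactly one of the following holds. (i) $P$ has a forcing cycle $\mathcal C$ with $val(\mathcal C)>0$; in this case $P$ is not an $S$-order for any nonempty $S\subseteq\{A,B,C,D\}$. (ii) All forcing cycles $\mathcal C$ in $P$ have $val(\mathcal C)<0$; in this case $P$ is a unit interval order and an $S$-order for every nonempty $S\subseteq\{A,B,C,D\}$. (iii) No forcing cycle in $P$ has positive value and some forcing cycle has value $0$; in this case, for every value-$0$ forcing cycle $\mathcal C: x_0,x_1,\dots,x_t$ and every nonempty $S$, any $S$-representation of $P$ in which all intervals have length $2$ satisfies $c(x_i)=c(x_0)+val_{\mathcal C}(x_i)$ for all $0\le i\le t$.
   Context: Interval types: every interval $I_v$ has left endpoint $L(v)$, right endpoint $R(v)$, center $c(v)=(L(v)+R(v))/2$, and one of four types: $A$ (endpoints closed, center closed), $B$ (endpoints open, center open), $C$ (endpoints closed, center open), $D$ (endpoints open, center closed); the center always belongs to the interval. For nonempty $S\subseteq\{A,B,C,D\}$, an $S$-representation of a poset $(X,\prec)$ assigns to each $x\in X$ an interval $I_x$, all of the same positive length, each of type in $S$, such that $x\prec y$ iff (i) $R(x)<c(y)$, or (ii) $R(x)=c(y)$, at least one of $R(x),c(y)$ is open, and at least one of $L(y),c(x)$ is open. An $S$-order is a poset with an $S$-representation. A unit interval order is a poset representable by real intervals of equal length with $x\prec y$ iff every point of $I_x$ is less than every point of $I_y$. For distinct elements, $x\parallel y$ means incomparable. A forcing trail is a sequence $x_0,\dots,x_t$ with $x_i\prec x_{i+1}$ or $x_i\parallel x_{i+1}$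 for each $0\le i\le t-1$; $up_{\mathcal T}(x_i)$ (resp. $side_{\mathcal T}(x_i)$) is the number of $j\in\{0,\dots,i-1\}$ with $x_j\prec x_{j+1}$ (resp. $x_j\parallel x_{j+1}$), and $val_{\mathcal T}(x_i)=up_{\mathcal T}(x_i)-side_{\mathcal T}(x_i)$. A forcing cycle is a forcing trail $x_0,\dots,x_t$ with $t\ge1$ and $x_t=x_0$ (other repetitions allowed); its value is $val(\mathcal C)=val_{\mathcal C}(x_t)$. -}

module Defs where

open import Level using (Level; _⊔_) renaming (suc to lsuc)
open import Data.Nat using (ℕ; zero; suc)
open import Data.Integer as ℤ using (ℤ; +_; -[1+_]; 0ℤ; 1ℤ)
open import Data.Fin using (Fin; zero; suc; inject₁; fromℕ)
open import Data.Bool using (Bool; true; false; T)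
open import Data.Product using (Σ; ∃; _×_; _,_)
open import Data.Sum using (_⊎_; inj₁; inj₂)
open import Relation.Nullary using (¬_)
open import Relation.Binary.PropositionalEquality using (_≡_; _≢_)
open import Relation.Binary.Structures using (IsStrictTotalOrder)
open import Algebra.Structures using (IsCommutativeRing)
open import Function.Bundles using (_⇔_)

record OrderedField (c ℓ : Level) : Set (lsuc (c ⊔ ℓ)) where
  infixl 6 _+_
  infixl 7 _*_
  infix 4 _<_
  field
    Carrier : Set c
    _+_ _*_ : Carrier → Carrier → Carrier
    -_      : Carrier → Carrier
    0# 1#   : Carrier
    _<_     : Carrier → Carrier → Set ℓ
    isCommutativeRing   : IsCommutativeRing _≡_ _+_ _*_ -_ 0# 1#
    isStrictTotalOrder  : IsStrictTotalOrder _≡_ _<_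
    0≢1     : 0# ≢ 1#
    inverse : ∀ x → x ≢ 0# → ∃ λ y → x * y ≡ 1#
    +-mono-< : ∀ {x y} z → x < y → x + z < y + z
    *-pos    : ∀ {x y} → 0# < x → 0# < y → 0# < x * y

  fromℕ' : ℕ → Carrier
  fromℕ' zero    = 0#
  fromℕ' (suc n) = 1# + fromℕ' n

  fromℤ : ℤ → Carrier
  fromℤ (+ n)      = fromℕ' n
  fromℤ -[1+ n ]   = - fromℕ' (suc n)

  2# : Carrier
  2# = 1# + 1#

module _ {n : ℕ} (_≺_ : Fin n → Fin n → Set) where

  _∥_ : Fin n → Fin n → Set
  x ∥ y = x ≢ y × ¬ (x ≺ y) × ¬ (y ≺ x)

  Step : Fin n → Fin n → Set
  Step x y = (x ≺ y) ⊎ (x ∥ y)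

  stepVal : ∀ {x y} → Step x y → ℤ
  stepVal (inj₁ _) = 1ℤ
  stepVal (inj₂ _) = ℤ.- 1ℤ

  record ForcingTrail (t : ℕ) : Set where
    field
      xs    : Fin (suc t) → Fin n
      steps : (j : Fin t) → Step (xs (inject₁ j)) (xs (suc j))

  -- val_T(x_i) = up_T(x_i) - side_T(x_i)
  valAt : ∀ {t} (xs : Fin (suc t) → Fin n)
          → ((j : Fin t) → Step (xs (inject₁ j)) (xs (suc j)))
          → Fin (suc t) → ℤ
  valAt xs st zero = 0ℤ
  valAt {suc t} xs st (suc i) =
    stepVal (st zero) ℤ.+ valAt (λ k → xs (suc k)) (λ j → st (suc j)) i

  -- forcing cycle x₀,…,x_t with t ≥ 1 (t = suc t') and x_t = x₀
  record ForcingCycle : Set where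
    field
      t'     : ℕ
      trail  : ForcingTrail (suc t')
    open ForcingTrail trail public
    field
      closed : xs (fromℕ (suc t')) ≡ xs zero

    valOf : Fin (suc (suc t')) → ℤ
    valOf = valAt xs steps

    val : ℤ
    val = valOf (fromℕ (suc t'))

data IType : Set where
  A B C D : IType

endpointsClosed : IType → Bool
endpointsClosed A = true
endpointsClosed B = false
endpointsClosed C = true
endpointsClosed D = false

centerClosed : IType → Bool
centerClosed A = true
centerClosed B = false
centerClosed C = false
centerClosed D = true

NonEmpty : (IType → Bool) → Set
NonEmpty S = ∃ λ τ → T (S τ)

module _ {c ℓ} (K : OrderedField c ℓ) where
  open OrderedField K

  module _ {n : ℕ} (_≺_ : Fin n → Fin n → Set) (S : IType → Bool) where

    record SRepresentation : Set (c ⊔ ℓ) where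
      field
        L R cen : Fin n → Carrier
        len     : Carrier
        len-pos : 0# < len
        R-def   : ∀ x → R x ≡ L x + len
        cen-def : ∀ x → cen x + cen x ≡ L x + R x
        type    : Fin n → IType
        type∈S  : ∀ x → T (S (type x))

      ROpen : Fin n → Set
      ROpen x = endpointsClosed (type x) ≡ false
      LOpen : Fin n → Set
      LOpen x = endpointsClosed (type x) ≡ false
      cOpen : Fin n → Set
      cOpen x = centerClosed (type x) ≡ false

      field
        represents : ∀ x y →
          (x ≺ y) ⇔ (R x < cen y
                     ⊎ (R x ≡ cen y × (ROpen x ⊎ cOpen y) × (LOpen y ⊎ cOpen x)))

    IsSOrder : Set (c ⊔ ℓ)
    IsSOrder = SRepresentation

  -- unit interval order: closed intervals [L x, L x + len], all of length len > 0,
  -- x ≺ y iff every point of I_x is below every point of I_y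
  record UnitIntervalRep {n : ℕ} (_≺_ : Fin n → Fin n → Set) : Set (c ⊔ ℓ) where
    field
      L       : Fin n → Carrier
      len     : Carrier
      len-pos : 0# < len
      represents : ∀ x y → (x ≺ y) ⇔ (L x + len < L y)

  IsUnitIntervalOrder : {n : ℕ} (_≺_ : Fin n → Fin n → Set) → Set (c ⊔ ℓ)
  IsUnitIntervalOrder = UnitIntervalRep

-- In an S-representation whose intervals have length λ, every step x, y of a
-- forcing trail satisfies 2c(x) + λ·val ≤ 2c(y), where val = 1 for an up-step and
-- val = -1 for a side-step: x ≺ y forces R(x) ≤ c(y), and x ∥ y forbids R(y) < c(x).
-- Summed around a forcing cycle this gives λ·val(C) ≤ 0, so a positive cycle admits
-- no representation, and around a cycle of value 0 every inequality is tight, which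
-- fixes the centres. If every cycle is negative, the heaviest walks of length ≤ n
-- (for the step weights (n + 1)·val + 1) give integer points p with
-- x ≺ y ⇔ p(x) + n + 1 < p(y) and no ties, which serve for every choice of interval
-- types. Finally, a cycle longer than n splits at a repeated element into two
-- shorter cycles, so only the finitely many cycles of length ≤ n decide which case holds.

module Submission where

open import Defs
open import Data.Nat as ℕ using (ℕ; zero; suc; z≤n; s≤s)
import Data.Nat.Properties as ℕP
open import Data.Integer as ℤ using (ℤ; 0ℤ; 1ℤ)
import Data.Integer.Properties as ℤP
open import Data.Integer.Tactic.RingSolver using (solve-∀)
open import Data.Fin using (Fin; zero; suc; toℕ; fromℕ; fromℕ<; inject₁; _≟_)
import Data.Fin.Properties as FinP
open import Data.List using (tabulate)
open import Data.List.Relation.Unary.All.Properties using (tabulate⁺; tabulate⁻)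
open import Data.List.Extrema ℤP.≤-totalOrder using (argmax; argmax-all; f[⊥]≤f[argmax]; f[xs]≤f[argmax])
open import Data.Product using (Σ; ∃; -,_; _×_; _,_; proj₁; proj₂)
open import Data.Sum using (_⊎_; inj₁; inj₂; map₂)
open import Data.Bool using (Bool; T)
open import Data.Empty using (⊥-elim)
open import Function using (_∘_; Injective)
open import Function.Bundles using (mk⇔; Equivalence)
open import Relation.Nullary using (¬_; Dec; yes; no)
open import Relation.Nullary.Decidable using (map′; ¬?; _×-dec_; _⊎-dec_)
open import Relation.Binary.Bundles using (StrictPartialOrder)
open import Relation.Binary.Definitions using (Decidable; tri<; tri≈; tri>)
open import Relation.Binary.Structures using (IsStrictPartialOrder; IsStrictTotalOrder)
open import Relation.Binary.PropositionalEquality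
  using (_≡_; _≢_; refl; sym; trans; cong; cong₂; subst; subst₂; isEquivalence; resp₂; module ≡-Reasoning)
open import Algebra.Bundles using (CommutativeRing)
import Algebra.Properties.Ring as RingProperties
import Algebra.Properties.CommutativeSemigroup as CommutativeSemigroupProperties
import Relation.Binary.Construct.StrictToNonStrict as StrictToNonStrict
import Relation.Binary.Reasoning.StrictPartialOrder as StrictReasoning

module OrderedFieldProperties {c ℓ} (K : OrderedField c ℓ) where

  open OrderedField K public

  private
    commutativeRing : CommutativeRing c c
    commutativeRing = record { isCommutativeRing = isCommutativeRing }

  open CommutativeRing commutativeRing public
    using (+-assoc; +-comm; +-identityˡ; +-identityʳ; -‿inverseʳ;
           *-identityˡ; *-identityʳ; distribˡ; distribʳ; zeroˡ)
  open RingProperties (CommutativeRing.ring commutativeRing)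
    using (-0#≈0#; -‿involutive; -‿+-comm; -‿distribˡ-*)
  open CommutativeSemigroupProperties (CommutativeRing.+-commutativeSemigroup commutativeRing)
    public using (interchange)
  open IsStrictTotalOrder isStrictTotalOrder public
    using (compare) renaming (trans to <-trans; irrefl to <-irrefl; asym to <-asym)
  open StrictToNonStrict _≡_ _<_ public using (_≤_; <⇒≤)

  private
    a+[b-a]≡b : ∀ a b → a ℤ.+ (b ℤ.- a) ≡ b
    a+[b-a]≡b = solve-∀

  strictPartialOrder : StrictPartialOrder c c ℓ
  strictPartialOrder = record { isStrictPartialOrder = IsStrictTotalOrder.isStrictPartialOrder isStrictTotalOrder }

  module ≤-Reasoning = StrictReasoning strictPartialOrder

  ≤-refl : ∀ {x} → x ≤ x
  ≤-refl = inj₂ refl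

  ≤-trans : ∀ {x y z} → x ≤ y → y ≤ z → x ≤ z
  ≤-trans = StrictToNonStrict.trans _≡_ _<_ isEquivalence (resp₂ _<_) <-trans

  ≤-antisym : ∀ {x y} → x ≤ y → y ≤ x → x ≡ y
  ≤-antisym = StrictToNonStrict.antisym _≡_ _<_ isEquivalence <-trans <-irrefl

  <-≤-trans : ∀ {x y z} → x < y → y ≤ z → x < z
  <-≤-trans = StrictToNonStrict.<-≤-trans _≡_ _<_ <-trans (proj₁ (resp₂ _<_))

  ≮⇒≥ : ∀ {x y} → ¬ (x < y) → y ≤ x
  ≮⇒≥ {x} {y} x≮y with compare x y
  ... | tri< x<y _ _ = ⊥-elim (x≮y x<y)
  ... | tri≈ _ x≡y _ = inj₂ (sym x≡y)
  ... | tri> _ _ y<x = inj₁ y<x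

  +-monoʳ-< : ∀ {x y} z → x < y → z + x < z + y
  +-monoʳ-< {x} {y} z x<y = subst₂ _<_ (+-comm x z) (+-comm y z) (+-mono-< z x<y)

  +-monoˡ-≤ : ∀ {x y} z → x ≤ y → x + z ≤ y + z
  +-monoˡ-≤ z (inj₁ x<y)  = inj₁ (+-mono-< z x<y)
  +-monoˡ-≤ z (inj₂ refl) = ≤-refl

  +-monoʳ-≤ : ∀ {x y} z → x ≤ y → z + x ≤ z + y
  +-monoʳ-≤ {x} {y} z x≤y = subst₂ _≤_ (+-comm x z) (+-comm y z) (+-monoˡ-≤ z x≤y)

  +-mono-≤ : ∀ {x y u v} → x ≤ y → u ≤ v → x + u ≤ y + v
  +-mono-≤ {y = y} {u} x≤y u≤v = ≤-trans (+-monoˡ-≤ u x≤y) (+-monoʳ-≤ y u≤v)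

  x+y-y≡x : ∀ x y → x + y + - y ≡ x
  x+y-y≡x x y = begin
    x + y + - y    ≡⟨ +-assoc x y (- y) ⟩
    x + (y + - y)  ≡⟨ cong (x +_) (-‿inverseʳ y) ⟩
    x + 0#         ≡⟨ +-identityʳ x ⟩
    x              ∎
    where open ≡-Reasoning

  ≤⇒≯ : ∀ {x y} → x ≤ y → ¬ (y < x)
  ≤⇒≯ (inj₁ x<y)  y<x = <-asym x<y y<x
  ≤⇒≯ (inj₂ refl) x<x = <-irrefl refl x<x

  +-mono-<-< : ∀ {x y u v} → x < y → u < v → x + u < y + v
  +-mono-<-< {x} {y} {u} x<y u<v = <-trans (+-mono-< u x<y) (+-monoʳ-< y u<v)

  x+x≡y+y⇒x≡y : ∀ {x y} → x + x ≡ y + y → x ≡ y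
  x+x≡y+y⇒x≡y {x} {y} eq with compare x y
  ... | tri< x<y _ _ = ⊥-elim (<-irrefl eq (+-mono-<-< x<y x<y))
  ... | tri≈ _ x≡y _ = x≡y
  ... | tri> _ _ y<x = ⊥-elim (<-irrefl (sym eq) (+-mono-<-< y<x y<x))

  0<1 : 0# < 1#
  0<1 with compare 0# 1#
  ... | tri< 0<1 _ _ = 0<1
  ... | tri≈ _ 0≡1 _ = ⊥-elim (0≢1 0≡1)
  ... | tri> _ _ 1<0 = ⊥-elim (<-asym 1<0 (subst (0# <_) -1*-1≡1 (*-pos 0<-1 0<-1)))
    where
      0<-1 : 0# < - 1#
      0<-1 = subst₂ _<_ (-‿inverseʳ 1#) (+-identityˡ (- 1#)) (+-mono-< (- 1#) 1<0)
      -1*-1≡1 : - 1# * - 1# ≡ 1#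
      -1*-1≡1 = begin
        - 1# * - 1#    ≡⟨ -‿distribˡ-* 1# (- 1#) ⟨
        - (1# * - 1#)  ≡⟨ cong -_ (*-identityˡ (- 1#)) ⟩
        - - 1#         ≡⟨ -‿involutive 1# ⟩
        1#             ∎
        where open ≡-Reasoning

  fromℕ'-+ : ∀ m k → fromℕ' (m ℕ.+ k) ≡ fromℕ' m + fromℕ' k
  fromℕ'-+ zero    k = sym (+-identityˡ (fromℕ' k))
  fromℕ'-+ (suc m) k = trans (cong (1# +_) (fromℕ'-+ m k)) (sym (+-assoc 1# (fromℕ' m) (fromℕ' k)))

  fromℤ-⊖ : ∀ m k → fromℤ (m ℤ.⊖ k) ≡ fromℕ' m + - fromℕ' k
  fromℤ-⊖ m       zero    = sym (trans (cong (fromℕ' m +_) -0#≈0#) (+-identityʳ (fromℕ' m)))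
  fromℤ-⊖ zero    (suc k) = sym (+-identityˡ _)
  fromℤ-⊖ (suc m) (suc k) = begin
    fromℤ (suc m ℤ.⊖ suc k)                  ≡⟨ cong fromℤ (ℤP.[1+m]⊖[1+n]≡m⊖n m k) ⟩
    fromℤ (m ℤ.⊖ k)                          ≡⟨ fromℤ-⊖ m k ⟩
    a + - b                                  ≡⟨ +-identityˡ (a + - b) ⟨
    0# + (a + - b)                           ≡⟨ cong (_+ (a + - b)) (-‿inverseʳ 1#) ⟨
    (1# + - 1#) + (a + - b)                  ≡⟨ interchange 1# (- 1#) a (- b) ⟩
    (1# + a) + (- 1# + - b)                  ≡⟨ cong ((1# + a) +_) (-‿+-comm 1# b) ⟩
    (1# + a) + - (1# + b)                    ∎
    where
      open ≡-Reasoning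
      a b : Carrier
      a = fromℕ' m
      b = fromℕ' k

  fromℤ-+ : ∀ a b → fromℤ (a ℤ.+ b) ≡ fromℤ a + fromℤ b
  fromℤ-+ ℤ.-[1+ m ] ℤ.-[1+ k ] = begin
    - fromℕ' (suc (suc (m ℕ.+ k)))        ≡⟨ cong (λ i → - fromℕ' (suc i)) (ℕP.+-suc m k) ⟨
    - fromℕ' (suc m ℕ.+ suc k)            ≡⟨ cong -_ (fromℕ'-+ (suc m) (suc k)) ⟩
    - (fromℕ' (suc m) + fromℕ' (suc k))   ≡⟨ -‿+-comm (fromℕ' (suc m)) (fromℕ' (suc k)) ⟨
    - fromℕ' (suc m) + - fromℕ' (suc k)   ∎
    where open ≡-Reasoning
  fromℤ-+ ℤ.-[1+ m ] (ℤ.+ k)   = trans (fromℤ-⊖ k (suc m)) (+-comm _ _)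
  fromℤ-+ (ℤ.+ m)   ℤ.-[1+ k ] = fromℤ-⊖ m (suc k)
  fromℤ-+ (ℤ.+ m)   (ℤ.+ k)    = fromℕ'-+ m k

  fromℤ-1*x : ∀ x → fromℤ 1ℤ * x ≡ x
  fromℤ-1*x x = trans (cong (_* x) (+-identityʳ 1#)) (*-identityˡ x)

  fromℤ-[-1]*x : ∀ x → fromℤ (ℤ.- 1ℤ) * x ≡ - x
  fromℤ-[-1]*x x = trans (sym (-‿distribˡ-* (fromℤ 1ℤ) x)) (cong -_ (fromℤ-1*x x))

  x*2#≡x+x : ∀ x → x * 2# ≡ x + x
  x*2#≡x+x x = trans (distribˡ x 1# 1#) (cong₂ _+_ (*-identityʳ x) (*-identityʳ x))

  0<fromℤ1 : 0# < fromℤ 1ℤ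
  0<fromℤ1 = subst (0# <_) (sym (+-identityʳ 1#)) 0<1

  fromℕ'-nonneg : ∀ k → 0# ≤ fromℕ' k
  fromℕ'-nonneg zero    = ≤-refl
  fromℕ'-nonneg (suc k) = inj₁ (<-≤-trans 0<fromℤ1 (+-monoʳ-≤ 1# (fromℕ'-nonneg k)))

  fromℤ-mono-≤ : ∀ {a b} → a ℤ.≤ b → fromℤ a ≤ fromℤ b
  fromℤ-mono-≤ {a} {b} a≤b =
    subst₂ _≤_ (+-identityʳ (fromℤ a)) fromℤb (+-monoʳ-≤ (fromℤ a) (fromℕ'-nonneg k))
    where
      k : ℕ
      k = ℤ.∣ b ℤ.- a ∣
      a+k≡b : a ℤ.+ ℤ.+ k ≡ b
      a+k≡b = trans (cong (λ i → a ℤ.+ i) (ℤP.0≤i⇒+∣i∣≡i (ℤP.i≤j⇒0≤j-i a≤b))) (a+[b-a]≡b a b)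
      fromℤb : fromℤ a + fromℕ' k ≡ fromℤ b
      fromℤb = trans (sym (fromℤ-+ a (ℤ.+ k))) (cong fromℤ a+k≡b)

  fromℤ-mono-< : ∀ {a b} → a ℤ.< b → fromℤ a < fromℤ b
  fromℤ-mono-< {a} {b} a<b = <-≤-trans a<1+a (fromℤ-mono-≤ (ℤP.i<j⇒suc[i]≤j a<b))
    where
      a<1+a : fromℤ a < fromℤ (1ℤ ℤ.+ a)
      a<1+a = subst₂ _<_ (+-identityˡ (fromℤ a)) (sym (fromℤ-+ 1ℤ a)) (+-mono-< (fromℤ a) 0<fromℤ1)

  fromℤ-cancel-≤ : ∀ {a b} → fromℤ a ≤ fromℤ b → a ℤ.≤ b
  fromℤ-cancel-≤ {a} {b} fa≤fb = ℤP.≮⇒≥ (λ b<a → ≤⇒≯ fa≤fb (fromℤ-mono-< b<a))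

module WeightedWalks {n : ℕ} (E : Fin n → Fin n → Set) (weight : ∀ {x y} → E x y → ℤ) where

  private variable
    x y z : Fin n

  private
    +-exchange : ∀ a b c → a ℤ.+ (b ℤ.+ c) ≡ b ℤ.+ (a ℤ.+ c)
    +-exchange = solve-∀

  infixr 5 _∷_
  data Walk : Fin n → Fin n → Set where
    []  : Walk x x
    _∷_ : E x y → Walk y z → Walk x z

  length : Walk x z → ℕ
  length []      = 0
  length (_ ∷ w) = suc (length w)

  value : Walk x z → ℤ
  value []      = 0ℤ
  value (e ∷ w) = weight e ℤ.+ value w

  vertex : (w : Walk x z) → Fin (suc (length w)) → Fin n
  vertex {x = x} w zero    = x
  vertex (_ ∷ w)   (suc i) = vertex w i

  vertex-last : (w : Walk x z) → vertex w (fromℕ (length w)) ≡ z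
  vertex-last []      = refl
  vertex-last (_ ∷ w) = vertex-last w

  edge : (w : Walk x z) (j : Fin (length w)) → E (vertex w (inject₁ j)) (vertex w (suc j))
  edge (e ∷ _) zero    = e
  edge (_ ∷ w) (suc j) = edge w j

  splitAt : (w : Walk x z) (i : Fin (suc (length w))) →
            Σ (Walk x (vertex w i)) λ a → Σ (Walk (vertex w i) z) λ b →
              length w ≡ length a ℕ.+ length b × value w ≡ value a ℤ.+ value b
  splitAt w       zero    = [] , w , refl , sym (ℤP.+-identityˡ (value w))
  splitAt (e ∷ w) (suc i) with splitAt w i
  ... | a , b , length-split , value-split =
    e ∷ a , b , cong suc length-split ,
    trans (cong (λ v → weight e ℤ.+ v) value-split) (sym (ℤP.+-assoc (weight e) (value a) (value b)))

  record Cycle : Set where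
    constructor cycle
    field
      {base}   : Fin n
      walk     : Walk base base
      nonempty : 0 ℕ.< length walk

    len : ℕ
    len = length walk

    val : ℤ
    val = value walk

  record LoopSplit (w : Walk x z) : Set where
    field
      loop         : Cycle
      rest         : Walk x z
      length-split : length w ≡ Cycle.len loop ℕ.+ length rest
      value-split  : value w ≡ Cycle.val loop ℤ.+ value rest

  LoopSplit-∷ : (e : E x y) {w : Walk y z} → LoopSplit w → LoopSplit (e ∷ w)
  LoopSplit-∷ e s = record
    { loop         = loop
    ; rest         = e ∷ rest
    ; length-split = trans (cong suc length-split) (sym (ℕP.+-suc (Cycle.len loop) (length rest)))
    ; value-split  = trans (cong (λ v → weight e ℤ.+ v) value-split)
                           (+-exchange (weight e) (Cycle.val loop) (value rest))
    }
    where open LoopSplit s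

  private
    loop-at-start : (e : E x y) (w : Walk y z) (i : Fin (suc (length w))) →
                    x ≡ vertex w i → LoopSplit (e ∷ w)
    loop-at-start e w i refl with splitAt w i
    ... | a , b , length-split , value-split = record
      { loop         = cycle (e ∷ a) (s≤s z≤n)
      ; rest         = b
      ; length-split = cong suc length-split
      ; value-split  = trans (cong (λ v → weight e ℤ.+ v) value-split)
                             (sym (ℤP.+-assoc (weight e) (value a) (value b)))
      }

    vertex-∷-injective : (e : E x y) (w : Walk y z) → (∀ i → x ≢ vertex w i) →
                         Injective _≡_ _≡_ (vertex w) → Injective _≡_ _≡_ (vertex (e ∷ w))
    vertex-∷-injective e w x∉w inj {zero}  {zero}  _   = refl
    vertex-∷-injective e w x∉w inj {zero}  {suc j} x≡wⱼ = ⊥-elim (x∉w j x≡wⱼ)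
    vertex-∷-injective e w x∉w inj {suc i} {zero}  wᵢ≡x = ⊥-elim (x∉w i (sym wᵢ≡x))
    vertex-∷-injective e w x∉w inj {suc i} {suc j} wᵢ≡wⱼ = cong suc (inj wᵢ≡wⱼ)

  loop-or-injective : (w : Walk x z) → LoopSplit w ⊎ Injective _≡_ _≡_ (vertex w)
  loop-or-injective []              = inj₂ λ { {zero} {zero} _ → refl }
  loop-or-injective {x = x} (e ∷ w) with FinP.any? (λ i → x ≟ vertex w i)
  ... | yes (i , x≡wᵢ) = inj₁ (loop-at-start e w i x≡wᵢ)
  ... | no x∉w with loop-or-injective w
  ...   | inj₁ s   = inj₁ (LoopSplit-∷ e s)
  ...   | inj₂ inj = inj₂ (vertex-∷-injective e w (λ i x≡wᵢ → x∉w (i , x≡wᵢ)) inj)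

  long-walk-loop : (w : Walk x z) → n ℕ.≤ length w → LoopSplit w
  long-walk-loop w n≤len with loop-or-injective w
  ... | inj₁ s   = s
  ... | inj₂ inj with FinP.pigeonhole (s≤s n≤len) (vertex w)
  ...   | i , j , i<j , wᵢ≡wⱼ = ⊥-elim (FinP.<-irrefl (inj wᵢ≡wⱼ) i<j)

  cycle-split : (γ : Cycle) → n ℕ.< Cycle.len γ →
                Σ Cycle λ γ₁ → Σ Cycle λ γ₂ →
                  Cycle.len γ ≡ Cycle.len γ₁ ℕ.+ Cycle.len γ₂ × Cycle.val γ ≡ Cycle.val γ₁ ℤ.+ Cycle.val γ₂
  cycle-split (cycle (e ∷ w) _) (s≤s n≤len) = loop , cycle rest (s≤s z≤n) , length-split , value-split
    where open LoopSplit (LoopSplit-∷ e (long-walk-loop w n≤len))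

  short-cycles-suffice : (P : ℤ → Set) → (∀ {a b} → P a → P b → P (a ℤ.+ b)) →
                         (∀ γ → Cycle.len γ ℕ.≤ n → P (Cycle.val γ)) → ∀ γ → P (Cycle.val γ)
  short-cycles-suffice P P-+ P-short γ = go (Cycle.len γ) γ ℕP.≤-refl
    where
      go : ∀ m γ → Cycle.len γ ℕ.≤ m → P (Cycle.val γ)
      go m       γ _       with Cycle.len γ ℕ.≤? n
      go m       γ _       | yes short = P-short γ short
      go zero    γ len≤0   | no _      = ⊥-elim (ℕP.<-irrefl refl (ℕP.<-≤-trans (Cycle.nonempty γ) len≤0))
      go (suc m) γ len≤1+m | no long with cycle-split γ (ℕP.≰⇒> long)
      ... | γ₁ , γ₂ , length-split , value-split =
        subst P (sym value-split) (P-+ (go m γ₁ (shorter (ℕP.m<m+n _ (Cycle.nonempty γ₂))))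
                                       (go m γ₂ (shorter (ℕP.m<n+m _ (Cycle.nonempty γ₁)))))
        where
          shorter : ∀ {k} → k ℕ.< Cycle.len γ₁ ℕ.+ Cycle.len γ₂ → k ℕ.≤ m
          shorter k<len = ℕP.≤-pred (ℕP.<-≤-trans k<len (subst (ℕ._≤ suc m) length-split len≤1+m))

  ShortCycleWith : (ℤ → Set) → Set
  ShortCycleWith P = Σ Cycle λ γ → Cycle.len γ ℕ.≤ n × P (Cycle.val γ)

  no-short-positive⇒nonpositive : ¬ ShortCycleWith (0ℤ ℤ.<_) → ∀ γ → Cycle.val γ ℤ.≤ 0ℤ
  no-short-positive⇒nonpositive ¬pos = short-cycles-suffice (ℤ._≤ 0ℤ) ℤP.+-mono-≤
    λ γ short → ℤP.≮⇒≥ λ 0<v → ¬pos (γ , short , 0<v)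

  no-short-zero⇒negative : (∀ γ → Cycle.val γ ℤ.≤ 0ℤ) → ¬ ShortCycleWith (_≡ 0ℤ) →
                           ∀ γ → Cycle.val γ ℤ.< 0ℤ
  no-short-zero⇒negative nonpos ¬zero = short-cycles-suffice (ℤ._< 0ℤ) ℤP.+-mono-<
    λ γ short → ℤP.≤∧≢⇒< (nonpos γ) λ v≡0 → ¬zero (γ , short , v≡0)

  module ShortCycleSearch (E? : Decidable E) (weight-irrelevant : ∀ {x y} (e e′ : E x y) → weight e ≡ weight e′) where

    WalkWith : ℕ → Fin n → Fin n → (ℤ → Set) → Set
    WalkWith k x z P = Σ (Walk x z) λ w → length w ≡ k × P (value w)

    walkWith? : ∀ k x z {P : ℤ → Set} → (∀ v → Dec (P v)) → Dec (WalkWith k x z P)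
    walkWith? zero x z P? with x ≟ z
    ... | no x≢z   = no λ { ([] , _ , _) → x≢z refl ; (_ ∷ _ , () , _) }
    ... | yes refl = map′ (λ p → [] , refl , p) (λ { ([] , _ , p) → p ; (_ ∷ _ , () , _) }) (P? 0ℤ)
    walkWith? (suc k) x z {P} P? =
      map′ (λ (_ , e , w , len≡k , p) → e ∷ w , cong suc len≡k , p)
           (λ { (e ∷ w , len≡1+k , p) → _ , e , w , ℕP.suc-injective len≡1+k , p ; ([] , () , _) })
           (FinP.any? first?)
      where
        first? : ∀ y → Dec (Σ (E x y) λ e → WalkWith k y z (λ v → P (weight e ℤ.+ v)))
        first? y with E? x y
        ... | no ¬e = no (¬e ∘ proj₁)
        ... | yes e = map′ (e ,_)
          (λ (e′ , w , len≡k , p) → w , len≡k , subst P (cong (ℤ._+ value w) (weight-irrelevant e′ e)) p)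
          (walkWith? k y z (λ v → P? (weight e ℤ.+ v)))

    shortCycleWith? : ∀ {P} → (∀ v → Dec (P v)) → Dec (ShortCycleWith P)
    shortCycleWith? P? =
      map′ (λ (x , i , w , len≡ , p) → cycle w (subst (0 ℕ.<_) (sym len≡) (s≤s z≤n)) ,
                                          subst (ℕ._≤ n) (sym len≡) (FinP.toℕ<n i) , p)
           (λ (γ , len≤n , p) → let i , len≡ = fin-pred (Cycle.nonempty γ) len≤n in
                                 Cycle.base γ , i , Cycle.walk γ , len≡ , p)
           (FinP.any? λ x → FinP.any? λ i → walkWith? (suc (toℕ i)) x x P?)
      where
        fin-pred : ∀ {m} → 0 ℕ.< m → m ℕ.≤ n → Σ (Fin n) λ i → m ≡ suc (toℕ i)
        fin-pred {suc m} _ m<n = fromℕ< m<n , cong suc (sym (FinP.toℕ-fromℕ< m<n))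

  module BellmanFord (E? : Decidable E) (weight-irrelevant : ∀ {x y} (e e′ : E x y) → weight e ≡ weight e′) where

    private
      scale-+ : ∀ s a b l m → s ℤ.* (a ℤ.+ b) ℤ.+ (l ℤ.+ m) ≡ (s ℤ.* a ℤ.+ l) ℤ.+ (s ℤ.* b ℤ.+ m)
      scale-+ = solve-∀

      scale-neg : ∀ s → s ℤ.* ℤ.- 1ℤ ℤ.+ s ≡ 0ℤ
      scale-neg = solve-∀

      move-left : ∀ a b c → (ℤ.- c ℤ.+ ℤ.- b) ℤ.+ (a ℤ.+ b) ≡ ℤ.- c ℤ.+ a
      move-left = solve-∀

      move-right : ∀ b c → (ℤ.- c ℤ.+ ℤ.- b) ℤ.+ c ≡ ℤ.- b
      move-right = solve-∀

    -- A cycle of length ≤ n + 1 and negative value has non-positive scaled weight, so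
    -- allowing n + 1 steps instead of n makes no walk heavier; the + 1 per edge makes
    -- the potential inequalities strict.
    scale : ℤ
    scale = ℤ.+ suc n

    scaled : Walk x z → ℤ
    scaled w = scale ℤ.* value w ℤ.+ ℤ.+ length w

    scaledWeight : E x y → ℤ
    scaledWeight e = scale ℤ.* weight e ℤ.+ 1ℤ

    scaled-∷ : (e : E x y) (w : Walk y z) → scaled (e ∷ w) ≡ scaledWeight e ℤ.+ scaled w
    scaled-∷ e w = scale-+ scale (weight e) (value w) 1ℤ (ℤ.+ length w)

    scaled-LoopSplit : {w : Walk x z} (s : LoopSplit w) →
                       scaled w ≡ scaled (Cycle.walk (LoopSplit.loop s)) ℤ.+ scaled (LoopSplit.rest s)
    scaled-LoopSplit s = trans (cong₂ (λ v l → scale ℤ.* v ℤ.+ ℤ.+ l) value-split length-split)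
                               (scale-+ scale (Cycle.val loop) (value rest) (ℤ.+ Cycle.len loop) (ℤ.+ length rest))
      where open LoopSplit s

    scaled⁺ : ∃ (Walk x) → ℤ
    scaled⁺ (_ , w) = scaled w

    heaviest : ℕ → (x : Fin n) → ∃ (Walk x)
    extension : ℕ → (x y : Fin n) → ∃ (Walk x)
    heaviest zero    x = x , []
    heaviest (suc k) x = argmax scaled⁺ (heaviest k x) (tabulate (extension k x))
    extension k x y with E? x y
    ... | yes e = -, e ∷ proj₂ (heaviest k y)
    ... | no _  = heaviest k x

    heaviest-length : ∀ k x → length (proj₂ (heaviest k x)) ℕ.≤ k
    heaviest-length zero    x = z≤n
    heaviest-length (suc k) x =
      argmax-all scaled⁺ {P = λ (_ , w) → length w ℕ.≤ suc k}
        (ℕP.m≤n⇒m≤1+n (heaviest-length k x)) (tabulate⁺ extension-length)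
      where
        extension-length : ∀ y → length (proj₂ (extension k x y)) ℕ.≤ suc k
        extension-length y with E? x y
        ... | yes _ = s≤s (heaviest-length k y)
        ... | no _  = ℕP.m≤n⇒m≤1+n (heaviest-length k x)

    extension-scaled : ∀ k (e : E x y) →
                       scaled (proj₂ (extension k x y)) ≡ scaledWeight e ℤ.+ scaled (proj₂ (heaviest k y))
    extension-scaled {x = x} {y = y} k e with E? x y
    ... | yes e′ = trans (scaled-∷ e′ _) (cong (λ v → scale ℤ.* v ℤ.+ 1ℤ ℤ.+ scaled (proj₂ (heaviest k y)))
                                                (weight-irrelevant e′ e))
    ... | no ¬e  = ⊥-elim (¬e e)

    heaviest-optimal : ∀ k (w : Walk x z) → length w ℕ.≤ k → scaled w ℤ.≤ scaled (proj₂ (heaviest k x))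
    heaviest-optimal zero    []      _ = ℤP.≤-refl
    heaviest-optimal {x = x} (suc k) [] _ =
      ℤP.≤-trans (heaviest-optimal k [] z≤n) (f[⊥]≤f[argmax] {f = scaled⁺} (heaviest k x) (tabulate (extension k x)))
    heaviest-optimal {x = x} (suc k) (_∷_ {y = y} e w) (s≤s len≤k) = begin
      scaled (e ∷ w)                                    ≡⟨ scaled-∷ e w ⟩
      scaledWeight e ℤ.+ scaled w                       ≤⟨ ℤP.+-monoʳ-≤ (scaledWeight e) (heaviest-optimal k w len≤k) ⟩
      scaledWeight e ℤ.+ scaled (proj₂ (heaviest k y))  ≡⟨ extension-scaled k e ⟨
      scaled (proj₂ (extension k x y))                  ≤⟨ tabulate⁻ (f[xs]≤f[argmax] {f = scaled⁺} (heaviest k x) _) y ⟩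
      scaled (proj₂ (heaviest (suc k) x))               ∎
      where open ℤP.≤-Reasoning

    module _ (negative : ∀ γ → Cycle.val γ ℤ.< 0ℤ) where

      scaled-cycle-nonpositive : (γ : Cycle) → Cycle.len γ ℕ.≤ suc n → scaled (Cycle.walk γ) ℤ.≤ 0ℤ
      scaled-cycle-nonpositive γ len≤1+n = begin
        scale ℤ.* Cycle.val γ ℤ.+ ℤ.+ Cycle.len γ  ≤⟨ ℤP.+-mono-≤ (ℤP.*-monoˡ-≤-nonNeg scale (ℤP.i<j⇒i≤pred[j] (negative γ)))
                                                                  (ℤ.+≤+ len≤1+n) ⟩
        scale ℤ.* ℤ.- 1ℤ ℤ.+ scale                  ≡⟨ scale-neg scale ⟩
        0ℤ                                           ∎
        where open ℤP.≤-Reasoning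

      heaviest-saturated : (w : Walk x z) → length w ℕ.≤ suc n → scaled w ℤ.≤ scaled (proj₂ (heaviest n x))
      heaviest-saturated w len≤1+n with length w ℕ.≤? n
      ... | yes len≤n = heaviest-optimal n w len≤n
      ... | no len≰n = begin
        scaled w                                    ≡⟨ scaled-LoopSplit s ⟩
        scaled (Cycle.walk loop) ℤ.+ scaled rest    ≤⟨ ℤP.+-monoˡ-≤ (scaled rest) (scaled-cycle-nonpositive loop loop≤) ⟩
        0ℤ ℤ.+ scaled rest                          ≡⟨ ℤP.+-identityˡ (scaled rest) ⟩
        scaled rest                                 ≤⟨ heaviest-optimal n rest rest≤ ⟩
        scaled (proj₂ (heaviest n _))               ∎
        where
          open ℤP.≤-Reasoning
          s : LoopSplit w
          s = long-walk-loop w (ℕP.<⇒≤ (ℕP.≰⇒> len≰n))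
          open LoopSplit s
          len≤ : Cycle.len loop ℕ.+ length rest ℕ.≤ suc n
          len≤ = subst (ℕ._≤ suc n) length-split len≤1+n
          loop≤ : Cycle.len loop ℕ.≤ suc n
          loop≤ = ℕP.≤-trans (ℕP.m≤m+n _ _) len≤
          rest≤ : length rest ℕ.≤ n
          rest≤ = ℕP.≤-pred (ℕP.<-≤-trans (ℕP.m<n+m _ (Cycle.nonempty loop)) len≤)

      potential : Fin n → ℤ
      potential x = ℤ.- scaled (proj₂ (heaviest n x))

      potential-step : (e : E x y) → potential x ℤ.+ scaledWeight e ℤ.≤ potential y
      potential-step {x} {y} e = subst₂ ℤ._≤_ (move-left (scaledWeight e) hy hx) (move-right hy hx)
                                   (ℤP.+-monoʳ-≤ (ℤ.- hx ℤ.+ ℤ.- hy) step)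
        where
          hx hy : ℤ
          hx = scaled (proj₂ (heaviest n x))
          hy = scaled (proj₂ (heaviest n y))
          step : scaledWeight e ℤ.+ hy ℤ.≤ hx
          step = subst (ℤ._≤ hx) (scaled-∷ e _)
                   (heaviest-saturated (e ∷ proj₂ (heaviest n y)) (s≤s (heaviest-length n y)))


-- Together the last two fields rule out L x + len ≡ L y, so the boundary cases of an
-- S-representation never arise.
record IntegerUnitIntervalRep {n : ℕ} (_≺_ : Fin n → Fin n → Set) : Set where
  field
    L       : Fin n → ℤ
    len     : ℤ
    len-pos : 0ℤ ℤ.< len
    ≺⇒<     : ∀ {x y} → x ≺ y → L x ℤ.+ len ℤ.< L y
    ≤⇒≺     : ∀ {x y} → L x ℤ.+ len ℤ.≤ L y → x ≺ y

module ForcingGraph {n : ℕ} (_≺_ : Fin n → Fin n → Set) where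

  open WeightedWalks (Step _≺_) (stepVal _≺_) public

  private variable
    x y z : Fin n

  private
    up-shift : ∀ a s → a ℤ.+ (s ℤ.* 1ℤ ℤ.+ 1ℤ) ≡ 1ℤ ℤ.+ (a ℤ.+ s)
    up-shift = solve-∀

    side-shift : ∀ a s → a ℤ.+ (s ℤ.* ℤ.- 1ℤ ℤ.+ 1ℤ) ℤ.+ s ≡ 1ℤ ℤ.+ a
    side-shift = solve-∀

  stepVal-irrelevant : (s s′ : Step _≺_ x y) → stepVal _≺_ s ≡ stepVal _≺_ s′
  stepVal-irrelevant (inj₁ _)               (inj₁ _)               = refl
  stepVal-irrelevant (inj₂ _)               (inj₂ _)               = refl
  stepVal-irrelevant (inj₁ x≺y)             (inj₂ (_ , x⊀y , _))   = ⊥-elim (x⊀y x≺y)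
  stepVal-irrelevant (inj₂ (_ , x⊀y , _))   (inj₁ x≺y)             = ⊥-elim (x⊀y x≺y)

  step? : Decidable _≺_ → Decidable (Step _≺_)
  step? ≺? x y = ≺? x y ⊎-dec (¬? (x ≟ y) ×-dec ¬? (≺? x y) ×-dec ¬? (≺? y x))

  Steps : ∀ {t} → (Fin (suc t) → Fin n) → Set
  Steps {t} xs = (j : Fin t) → Step _≺_ (xs (inject₁ j)) (xs (suc j))

  trail-walk : ∀ t (xs : Fin (suc t) → Fin n) (st : Steps xs) →
               Σ (Walk (xs zero) (xs (fromℕ t))) λ w →
                 length w ≡ t × value w ≡ valAt _≺_ xs st (fromℕ t)
  trail-walk zero    xs st = [] , refl , refl
  trail-walk (suc t) xs st with trail-walk t (xs ∘ suc) (st ∘ suc)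
  ... | w , len≡t , val≡ = st zero ∷ w , cong suc len≡t , cong (λ v → stepVal _≺_ (st zero) ℤ.+ v) val≡

  trail-split : ∀ t (xs : Fin (suc t) → Fin n) (st : Steps xs) (i : Fin (suc t)) →
                Σ (Walk (xs zero) (xs i)) λ a → Σ (Walk (xs i) (xs (fromℕ t))) λ b →
                  value a ≡ valAt _≺_ xs st i × value a ℤ.+ value b ≡ valAt _≺_ xs st (fromℕ t)
  trail-split t xs st zero with trail-walk t xs st
  ... | w , _ , val≡ = [] , w , refl , trans (ℤP.+-identityˡ (value w)) val≡
  trail-split (suc t) xs st (suc i) with trail-split t (xs ∘ suc) (st ∘ suc) i
  ... | a , b , a≡ , a+b≡ =
    st zero ∷ a , b , cong (λ v → stepVal _≺_ (st zero) ℤ.+ v) a≡ ,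
    trans (ℤP.+-assoc (stepVal _≺_ (st zero)) (value a) (value b)) (cong (λ v → stepVal _≺_ (st zero) ℤ.+ v) a+b≡)

  forcingCycle→cycle : (γ : ForcingCycle _≺_) → Σ Cycle λ γ′ → Cycle.val γ′ ≡ ForcingCycle.val γ
  forcingCycle→cycle γ = let w , len≡ , val≡ = closed-walk in cycle w (subst (0 ℕ.<_) (sym len≡) (s≤s z≤n)) , val≡
    where
      open ForcingCycle γ
      closed-walk : Σ (Walk (xs zero) (xs zero)) λ w → length w ≡ suc t' × value w ≡ val
      closed-walk = subst (λ z → Σ (Walk (xs zero) z) λ w → length w ≡ suc t' × value w ≡ val)
                          closed (trail-walk (suc t') xs steps)

  forcingCycle-split : (γ : ForcingCycle _≺_) (i : Fin (suc (suc (ForcingCycle.t' γ)))) →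
                       let open ForcingCycle γ in
                       Σ (Walk (xs zero) (xs i)) λ a → Σ (Walk (xs i) (xs zero)) λ b →
                         value a ≡ valOf i × value a ℤ.+ value b ≡ val
  forcingCycle-split γ i =
    subst (λ z → Σ (Walk (xs zero) (xs i)) λ a → Σ (Walk (xs i) z) λ b → value a ≡ valOf i × value a ℤ.+ value b ≡ val)
          closed (trail-split (suc t') xs steps i)
    where open ForcingCycle γ

  valAt-vertex : (w : Walk x z) → valAt _≺_ (vertex w) (edge w) (fromℕ (length w)) ≡ value w
  valAt-vertex []      = refl
  valAt-vertex (s ∷ w) = cong (λ v → stepVal _≺_ s ℤ.+ v) (valAt-vertex w)

  cycle→forcingCycle : (γ : Cycle) → Σ (ForcingCycle _≺_) λ γ′ → ForcingCycle.val γ′ ≡ Cycle.val γ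
  cycle→forcingCycle (cycle (s ∷ w) _) =
    record { t' = length w ; trail = record { xs = vertex (s ∷ w) ; steps = edge (s ∷ w) } ; closed = vertex-last w } ,
    valAt-vertex (s ∷ w)

  some-forcingCycle : (P : ℤ → Set) (γ : Cycle) → P (Cycle.val γ) →
                      ∃ λ (γ′ : ForcingCycle _≺_) → P (ForcingCycle.val γ′)
  some-forcingCycle P γ p = let γ′ , val≡ = cycle→forcingCycle γ in γ′ , subst P (sym val≡) p

  every-forcingCycle : (P : ℤ → Set) → (∀ γ → P (Cycle.val γ)) → ∀ (γ : ForcingCycle _≺_) → P (ForcingCycle.val γ)
  every-forcingCycle P all γ = let γ′ , val≡ = forcingCycle→cycle γ in subst P val≡ (all γ′)

  every-cycle : (P : ℤ → Set) → (∀ (γ : ForcingCycle _≺_) → P (ForcingCycle.val γ)) → ∀ γ → P (Cycle.val γ)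
  every-cycle P all γ = let γ′ , val≡ = cycle→forcingCycle γ in subst P val≡ (all γ′)

  HasPositiveCycle : Set
  HasPositiveCycle = ∃ λ (γ : ForcingCycle _≺_) → 0ℤ ℤ.< ForcingCycle.val γ

  AllCyclesNegative : Set
  AllCyclesNegative = ∀ (γ : ForcingCycle _≺_) → ForcingCycle.val γ ℤ.< 0ℤ

  MaxCycleValueZero : Set
  MaxCycleValueZero = (∀ (γ : ForcingCycle _≺_) → ¬ (0ℤ ℤ.< ForcingCycle.val γ))
                    × (∃ λ (γ : ForcingCycle _≺_) → ForcingCycle.val γ ≡ 0ℤ)

  module _ (≺? : Decidable _≺_) where

    open ShortCycleSearch (step? ≺?) stepVal-irrelevant
    open BellmanFord (step? ≺?) stepVal-irrelevant

    forcing-cycle-trichotomy : HasPositiveCycle ⊎ AllCyclesNegative ⊎ MaxCycleValueZero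
    forcing-cycle-trichotomy with shortCycleWith? (0ℤ ℤ.<?_)
    ... | yes (γ , _ , 0<v) = inj₁ (some-forcingCycle (0ℤ ℤ.<_) γ 0<v)
    ... | no ¬pos with shortCycleWith? (ℤ._≟ 0ℤ)
    ...   | yes (γ , _ , v≡0) =
      inj₂ (inj₂ (every-forcingCycle (λ v → ¬ (0ℤ ℤ.< v)) (ℤP.≤⇒≯ ∘ no-short-positive⇒nonpositive ¬pos) ,
                  some-forcingCycle (_≡ 0ℤ) γ v≡0))
    ...   | no ¬zero =
      inj₂ (inj₁ (every-forcingCycle (ℤ._< 0ℤ) (no-short-zero⇒negative (no-short-positive⇒nonpositive ¬pos) ¬zero)))

    negative-cycles⇒integerRep : AllCyclesNegative → IntegerUnitIntervalRep _≺_
    negative-cycles⇒integerRep neg = record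
      { L = p ; len = scale ; len-pos = 0<scale ; ≺⇒< = up ; ≤⇒≺ = ≤⇒≺ }
      where
        negative : ∀ γ → Cycle.val γ ℤ.< 0ℤ
        negative = every-cycle (ℤ._< 0ℤ) neg

        p : Fin n → ℤ
        p = potential negative

        0<scale : 0ℤ ℤ.< scale
        0<scale = ℤ.+<+ (s≤s z≤n)

        below : ∀ a → a ℤ.< a ℤ.+ scale
        below a = subst (ℤ._< a ℤ.+ scale) (ℤP.+-identityʳ a) (ℤP.+-monoʳ-< a 0<scale)

        up : x ≺ y → p x ℤ.+ scale ℤ.< p y
        up {x} {y} x≺y = ℤP.suc[i]≤j⇒i<j
          (subst (ℤ._≤ p y) (up-shift (p x) scale) (potential-step negative (inj₁ x≺y)))

        side : _∥_ _≺_ x y → p x ℤ.< p y ℤ.+ scale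
        side {x} {y} x∥y = ℤP.suc[i]≤j⇒i<j
          (subst (ℤ._≤ p y ℤ.+ scale) (side-shift (p x) scale)
                 (ℤP.+-monoˡ-≤ scale (potential-step negative (inj₂ x∥y))))

        ≤⇒≺ : p x ℤ.+ scale ℤ.≤ p y → x ≺ y
        ≤⇒≺ {x} {y} px+N≤py with ≺? x y | x ≟ y | ≺? y x
        ... | yes x≺y | _        | _       = x≺y
        ... | no _    | yes refl | _       = ⊥-elim (ℤP.<⇒≱ (below (p x)) px+N≤py)
        ... | no _    | no _     | yes y≺x = ⊥-elim (ℤP.<-irrefl refl (begin-strict
          p x             <⟨ below (p x) ⟩
          p x ℤ.+ scale   ≤⟨ px+N≤py ⟩
          p y             <⟨ below (p y) ⟩
          p y ℤ.+ scale   <⟨ up y≺x ⟩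
          p x             ∎))
          where open ℤP.≤-Reasoning
        ... | no x⊀y  | no x≢y   | no y⊀x  = ⊥-elim (ℤP.<⇒≱ (side (x≢y ∘ sym , y⊀x , x⊀y)) px+N≤py)

module _ {c ℓ} (K : OrderedField c ℓ) where

  open OrderedFieldProperties K

  module WalkBounds {n : ℕ} {E : Fin n → Fin n → Set} {weight : ∀ {x y} → E x y → ℤ}
                    (g : Fin n → Carrier) (u : Carrier)
                    (edge-bound : ∀ {x y} (e : E x y) → g x + fromℤ (weight e) * u ≤ g y) where

    open WeightedWalks E weight
    open ≤-Reasoning

    private variable
      x y z : Fin n

    ⟦_⟧ : ℤ → Carrier
    ⟦ v ⟧ = fromℤ v * u

    ⟦⟧-+ : ∀ a b → ⟦ a ℤ.+ b ⟧ ≡ ⟦ a ⟧ + ⟦ b ⟧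
    ⟦⟧-+ a b = trans (cong (_* u) (fromℤ-+ a b)) (distribʳ u (fromℤ a) (fromℤ b))

    x+⟦0⟧≡x : ∀ x → x + ⟦ 0ℤ ⟧ ≡ x
    x+⟦0⟧≡x x = trans (cong (x +_) (zeroˡ u)) (+-identityʳ x)

    walk-bound : (w : Walk x z) → g x + ⟦ value w ⟧ ≤ g z
    walk-bound {x = x} []                  = inj₂ (x+⟦0⟧≡x (g x))
    walk-bound {x = x} {z} (_∷_ {y = y} e w) = begin
      g x + ⟦ weight e ℤ.+ value w ⟧        ≡⟨ cong (g x +_) (⟦⟧-+ (weight e) (value w)) ⟩
      g x + (⟦ weight e ⟧ + ⟦ value w ⟧)    ≡⟨ +-assoc (g x) _ _ ⟨
      g x + ⟦ weight e ⟧ + ⟦ value w ⟧      ≤⟨ +-monoˡ-≤ ⟦ value w ⟧ (edge-bound e) ⟩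
      g y + ⟦ value w ⟧                     ≤⟨ walk-bound w ⟩
      g z                                   ∎

    cycle-nonpositive : 0# < u → (γ : Cycle) → ¬ (0ℤ ℤ.< Cycle.val γ)
    cycle-nonpositive 0<u (cycle {x} w _) 0<v = <-irrefl refl (begin-strict
      g x                ≡⟨ +-identityʳ (g x) ⟨
      g x + 0#           <⟨ +-monoʳ-< (g x) (*-pos (fromℤ-mono-< 0<v) 0<u) ⟩
      g x + ⟦ value w ⟧  ≤⟨ walk-bound w ⟩
      g x                ∎)

    zero-sum-tight : (a : Walk x y) (b : Walk y x) → value a ℤ.+ value b ≡ 0ℤ → g y ≡ g x + ⟦ value a ⟧
    zero-sum-tight {x = x} {y} a b sum≡0 = ≤-antisym upper (walk-bound a)
      where
        upper : g y ≤ g x + ⟦ value a ⟧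
        upper = begin
          g y                                 ≡⟨ x+⟦0⟧≡x (g y) ⟨
          g y + ⟦ 0ℤ ⟧                         ≡⟨ cong (λ v → g y + ⟦ v ⟧) (trans (sym sum≡0) (ℤP.+-comm (value a) (value b))) ⟩
          g y + ⟦ value b ℤ.+ value a ⟧        ≡⟨ cong (g y +_) (⟦⟧-+ (value b) (value a)) ⟩
          g y + (⟦ value b ⟧ + ⟦ value a ⟧)    ≡⟨ +-assoc (g y) _ _ ⟨
          g y + ⟦ value b ⟧ + ⟦ value a ⟧      ≤⟨ +-monoˡ-≤ ⟦ value a ⟧ (walk-bound b) ⟩
          g x + ⟦ value a ⟧                    ∎

  module SRepresentationBounds {n : ℕ} {_≺_ : Fin n → Fin n → Set} {S : IType → Bool}
                               (ρ : SRepresentation K _≺_ S) where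

    open SRepresentation ρ
    open ForcingGraph _≺_ using (Walk; value; Cycle; forcingCycle→cycle; forcingCycle-split)
    open ≤-Reasoning

    doubled : Fin n → Carrier
    doubled x = cen x + cen x

    doubled+len : ∀ x → doubled x + len ≡ R x + R x
    doubled+len x = begin-equality
      cen x + cen x + len   ≡⟨ cong (_+ len) (cen-def x) ⟩
      L x + R x + len       ≡⟨ cong (_+ len) (+-comm (L x) (R x)) ⟩
      R x + L x + len       ≡⟨ +-assoc (R x) (L x) len ⟩
      R x + (L x + len)     ≡⟨ cong (R x +_) (R-def x) ⟨
      R x + R x             ∎

    doubled-step : ∀ {x y} (s : Step _≺_ x y) → doubled x + fromℤ (stepVal _≺_ s) * len ≤ doubled y
    doubled-step {x} {y} (inj₁ x≺y) = begin
      doubled x + fromℤ 1ℤ * len   ≡⟨ cong (doubled x +_) (fromℤ-1*x len) ⟩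
      doubled x + len              ≡⟨ doubled+len x ⟩
      R x + R x                    ≤⟨ +-mono-≤ Rx≤cy Rx≤cy ⟩
      doubled y                    ∎
      where
        Rx≤cy : R x ≤ cen y
        Rx≤cy = map₂ proj₁ (Equivalence.to (represents x y) x≺y)
    doubled-step {x} {y} (inj₂ (_ , _ , y⊀x)) = begin
      doubled x + fromℤ (ℤ.- 1ℤ) * len   ≡⟨ cong (doubled x +_) (fromℤ-[-1]*x len) ⟩
      doubled x + - len                  ≤⟨ +-monoˡ-≤ (- len) (+-mono-≤ cx≤Ry cx≤Ry) ⟩
      R y + R y + - len                  ≡⟨ cong (_+ - len) (doubled+len y) ⟨
      doubled y + len + - len            ≡⟨ x+y-y≡x (doubled y) len ⟩
      doubled y                          ∎
      where
        cx≤Ry : cen x ≤ R y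
        cx≤Ry = ≮⇒≥ (λ Ry<cx → y⊀x (Equivalence.from (represents y x) (inj₁ Ry<cx)))

    open WalkBounds {weight = stepVal _≺_} doubled len doubled-step

    no-positive-forcingCycle : (γ : ForcingCycle _≺_) → ¬ (0ℤ ℤ.< ForcingCycle.val γ)
    no-positive-forcingCycle γ 0<v =
      let γ′ , val≡ = forcingCycle→cycle γ in cycle-nonpositive len-pos γ′ (subst (0ℤ ℤ.<_) (sym val≡) 0<v)

    zero-sum-centres : ∀ {x y} → len ≡ 2# → (a : Walk x y) (b : Walk y x) → value a ℤ.+ value b ≡ 0ℤ →
                       cen y ≡ cen x + fromℤ (value a)
    zero-sum-centres {x} {y} len≡2 a b sum≡0 = x+x≡y+y⇒x≡y (begin-equality
      doubled y                              ≡⟨ zero-sum-tight a b sum≡0 ⟩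
      doubled x + fromℤ (value a) * len      ≡⟨ cong (λ l → doubled x + fromℤ (value a) * l) len≡2 ⟩
      doubled x + fromℤ (value a) * 2#       ≡⟨ cong (doubled x +_) (x*2#≡x+x (fromℤ (value a))) ⟩
      doubled x + (fromℤ (value a) + fromℤ (value a))
                                             ≡⟨ interchange (cen x) (cen x) (fromℤ (value a)) (fromℤ (value a)) ⟩
      (cen x + fromℤ (value a)) + (cen x + fromℤ (value a)) ∎)

    zero-forcingCycle-centres : len ≡ 2# → (γ : ForcingCycle _≺_) → ForcingCycle.val γ ≡ 0ℤ →
                                let open ForcingCycle γ in ∀ i → cen (xs i) ≡ cen (xs zero) + fromℤ (valOf i)
    zero-forcingCycle-centres len≡2 γ val≡0 i =
      let a , b , a≡ , a+b≡ = forcingCycle-split γ i in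
      trans (zero-sum-centres len≡2 a b (trans a+b≡ val≡0)) (cong (λ v → cen (xs zero) + fromℤ v) a≡)
      where open ForcingCycle γ

  module FromIntegerRep {n : ℕ} {_≺_ : Fin n → Fin n → Set} (ρ : IntegerUnitIntervalRep _≺_) where

    open IntegerUnitIntervalRep ρ renaming (L to p; len to N; len-pos to 0<N)

    private
      left+width : ∀ p N → (p ℤ.- N) ℤ.+ (N ℤ.+ N) ≡ p ℤ.+ N
      left+width = solve-∀

      left+right : ∀ p N → p ℤ.+ p ≡ (p ℤ.- N) ℤ.+ (p ℤ.+ N)
      left+right = solve-∀

    unitIntervalRep : UnitIntervalRep K _≺_
    unitIntervalRep = record
      { L          = fromℤ ∘ p
      ; len        = fromℤ N
      ; len-pos    = fromℤ-mono-< 0<N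
      ; represents = λ x y → mk⇔
          (λ x≺y → subst (_< fromℤ (p y)) (fromℤ-+ (p x) N) (fromℤ-mono-< (≺⇒< x≺y)))
          (λ right-of → ≤⇒≺ (fromℤ-cancel-≤ (<⇒≤ (subst (_< fromℤ (p y)) (sym (fromℤ-+ (p x) N)) right-of))))
      }

    sRep : ∀ {S} τ → T (S τ) → SRepresentation K _≺_ S
    sRep τ τ∈S = record
      { L          = Lₓ
      ; R          = λ x → Lₓ x + fromℤ (N ℤ.+ N)
      ; cen        = fromℤ ∘ p
      ; len        = fromℤ (N ℤ.+ N)
      ; len-pos    = fromℤ-mono-< (ℤP.+-mono-< 0<N 0<N)
      ; R-def      = λ _ → refl
      ; cen-def    = cen-def
      ; type       = λ _ → τ
      ; type∈S     = λ _ → τ∈S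
      ; represents = λ x y → mk⇔
          (λ x≺y → inj₁ (subst (_< fromℤ (p y)) (sym (R≡ x)) (fromℤ-mono-< (≺⇒< x≺y))))
          (λ Rx≤cy → ≤⇒≺ (fromℤ-cancel-≤ (subst (_≤ fromℤ (p y)) (R≡ x) (map₂ proj₁ Rx≤cy))))
      }
      where
        Lₓ : Fin n → Carrier
        Lₓ x = fromℤ (p x ℤ.- N)

        R≡ : ∀ x → Lₓ x + fromℤ (N ℤ.+ N) ≡ fromℤ (p x ℤ.+ N)
        R≡ x = trans (sym (fromℤ-+ (p x ℤ.- N) (N ℤ.+ N))) (cong fromℤ (left+width (p x) N))

        cen-def : ∀ x → fromℤ (p x) + fromℤ (p x) ≡ Lₓ x + (Lₓ x + fromℤ (N ℤ.+ N))
        cen-def x = begin-equality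
          fromℤ (p x) + fromℤ (p x)             ≡⟨ fromℤ-+ (p x) (p x) ⟨
          fromℤ (p x ℤ.+ p x)                   ≡⟨ cong fromℤ (left+right (p x) N) ⟩
          fromℤ ((p x ℤ.- N) ℤ.+ (p x ℤ.+ N))   ≡⟨ fromℤ-+ (p x ℤ.- N) (p x ℤ.+ N) ⟩
          Lₓ x + fromℤ (p x ℤ.+ N)              ≡⟨ cong (Lₓ x +_) (R≡ x) ⟨
          Lₓ x + (Lₓ x + fromℤ (N ℤ.+ N))       ∎
          where open ≤-Reasoning

theorem8 : ∀ {c ℓ} (K : OrderedField c ℓ) (n : ℕ) (_≺_ : Fin n → Fin n → Set)
  → IsStrictPartialOrder _≡_ _≺_
  → Decidable _≺_
  → let open OrderedField K
        Case1 = ∃ λ (C : ForcingCycle _≺_) → 0ℤ ℤ.< ForcingCycle.val C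
        Case2 = ∀ (C : ForcingCycle _≺_) → ForcingCycle.val C ℤ.< 0ℤ
        Case3 = (∀ (C : ForcingCycle _≺_) → ¬ (0ℤ ℤ.< ForcingCycle.val C))
                × (∃ λ (C : ForcingCycle _≺_) → ForcingCycle.val C ≡ 0ℤ)
    in ((Case1 ⊎ Case2 ⊎ Case3)
        × ¬ (Case1 × Case2) × ¬ (Case1 × Case3) × ¬ (Case2 × Case3))
     × (Case1 → ∀ (S : IType → Bool) → NonEmpty S → ¬ IsSOrder K _≺_ S)
     × (Case2 → IsUnitIntervalOrder K _≺_
                × (∀ (S : IType → Bool) → NonEmpty S → IsSOrder K _≺_ S))
     × (Case3 → ∀ (C : ForcingCycle _≺_) → ForcingCycle.val C ≡ 0ℤ
              → ∀ (S : IType → Bool) → NonEmpty S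
              → ∀ (ρ : SRepresentation K _≺_ S) → SRepresentation.len ρ ≡ 2#
              → ∀ (i : Fin _)
              → SRepresentation.cen ρ (ForcingCycle.xs C i)
                ≡ SRepresentation.cen ρ (ForcingCycle.xs C zero)
                  + fromℤ (ForcingCycle.valOf C i))
theorem8 K n _≺_ _ ≺? =
    ( forcing-cycle-trichotomy ≺?
    , (λ ((γ , 0<v) , neg) → ℤP.<-asym 0<v (neg γ))
    , (λ ((γ , 0<v) , nonpos , _) → nonpos γ 0<v)
    , (λ (neg , _ , γ , v≡0) → ℤP.<-irrefl v≡0 (neg γ)))
  , (λ (γ , 0<v) _ _ ρ → SRepresentationBounds.no-positive-forcingCycle K ρ γ 0<v)
  , (λ neg → let open FromIntegerRep K (negative-cycles⇒integerRep ≺? neg) in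
             unitIntervalRep , λ _ (τ , τ∈S) → sRep τ τ∈S)
  , (λ _ γ val≡0 _ _ ρ len≡2 → SRepresentationBounds.zero-forcingCycle-centres K ρ len≡2 γ val≡0)
  where open ForcingGraph _≺_
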